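{- Let $G$ be a graph, $r,k\in\mathbb{N}$, and $M\subseteq V(G)$ a set of pairwise mds-exchangeable vertices with $|M|>r$. Let $G'$ be the graph obtained from $G$ by deleting all but $r$ vertices of $M$. Suppose that (i) $|D\cap M|\le r$ for every mds $D$ of $G$; (ii) the vertices of $M\cap V(G')$ are pairwise mds-exchangeable in $G'$; and (iii) every dominating set $D\subseteq V(G')$ of $G'$ is a dominating set of $G$. Then for all $t\le r$: $G$ is target-$t$ $k$-equidominating if and only if $G'$ is target-$t$ $k$-equidominating.
   Context: All graphs are finite, simple and undirected; $\mathbb{N}=\{1,2,\dots\}$. A set $D\subseteq V$ is dominating if every vertex is in $D$ or adjacent to a vertex of $D$; an mds is an inclusion-minimal dominating set. An equidominating structure of $G$ is a pair $(w,t)$ with $t\in\mathbb{N}$, $w\colon V\to\mathbb{N}$, such that for all $D\subseteq V$: $D$ is an mds iff $\sum_{v\in D}w(v)=t$. $G$ is target-$t$ $k$-equidominating if it has an equidominating structure $(w,t)$ with $w\colon V\to\{1,\dots,k\}$ and target value exactly $t$. Two vertices $x,y$ are mds-exchangeable (in a given graph) if some mds $D$ has $|\{x,y\}\cap D|=1$ and for every mds $D$ with $|\{x,y\}\cap D|=1$ the set $(D\setminus\{x,y\})\cup(\{x,y\}\setminus D)$ is an mds. -}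

module Defs where

open import Data.Nat as ℕ using (ℕ; zero; suc; _+_; _≤_; _<_)
open import Data.Fin as Fin using (Fin; zero)
open import Data.Fin.Subset using (Subset; _∈_; _∉_; _⊆_; ⊤; _─_; _∩_; ∣_∣)
open import Data.Bool using (Bool; true; false; not; if_then_else_)
open import Data.Vec using (Vec; []; _∷_; updateAt)
open import Data.Product using (Σ; ∃; _×_; _,_)
open import Data.Sum using (_⊎_)
open import Relation.Nullary using (¬_)
open import Relation.Binary.PropositionalEquality using (_≡_)
open import Function.Bundles using (_⇔_)

record Graph (n : ℕ) : Set₁ where
  field
    Adj    : Fin n → Fin n → Set
    sym    : ∀ {u v} → Adj u v → Adj v u
    irrefl : ∀ {v} → ¬ Adj v v

open Graph public

-- Throughout, a subset U ⊆ Fin n of vertices stands for the induced subgraph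
-- G[U]; the whole graph G is G[⊤].  Vertex sets of G[U] are subsets D ⊆ U.

module _ {n : ℕ} (G : Graph n) (U : Subset n) where

  Dominating : Subset n → Set
  Dominating D = D ⊆ U × (∀ v → v ∈ U → v ∈ D ⊎ ∃ λ u → u ∈ D × Adj G v u)

  IsMDS : Subset n → Set
  IsMDS D = Dominating D × (∀ D′ → D′ ⊆ D → Dominating D′ → D ⊆ D′)

wsum : ∀ {n} → Subset n → (Fin n → ℕ) → ℕ
wsum {zero}  []      w = 0
wsum {ℕ.suc n} (b ∷ D) w = (if b then w zero else 0) + wsum D (λ i → w (Fin.suc i))

toggle : ∀ {n} → Subset n → Fin n → Subset n
toggle D x = updateAt D x not

ExactlyOne : ∀ {n} → Fin n → Fin n → Subset n → Set
ExactlyOne x y D = (x ∈ D × y ∉ D) ⊎ (y ∈ D × x ∉ D)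

module _ {n : ℕ} (G : Graph n) (U : Subset n) where

  -- (w , t) is an equidominating structure of G[U]
  -- (w only matters on U; positivity of w is required on U below)
  IsEquidominating : (Fin n → ℕ) → ℕ → Set
  IsEquidominating w t = 1 ≤ t × (∀ D → D ⊆ U → (IsMDS G U D ⇔ (wsum D w ≡ t)))

  TargetKEquidominating : ℕ → ℕ → Set
  TargetKEquidominating t k =
    ∃ λ (w : Fin n → ℕ) → (∀ v → v ∈ U → 1 ≤ w v × w v ≤ k) × IsEquidominating w t

  MdsExchangeable : Fin n → Fin n → Set
  MdsExchangeable x y =
    (∃ λ D → IsMDS G U D × ExactlyOne x y D) ×
    (∀ D → IsMDS G U D → ExactlyOne x y D → IsMDS G U (toggle (toggle D x) y))

  PairwiseExchangeable : Subset n → Set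
  PairwiseExchangeable M =
    ∀ x y → x ∈ M → y ∈ M → ¬ (x ≡ y) → MdsExchangeable x y

module Submission where

-- G′ = G[U] with U = V ∖ (M ∖ R) keeps exactly the vertices R of M.
-- (⇒) By (iii), for D ⊆ U being an mds of G′ and of G are equivalent, so
--     restricting an equidominating structure of G to U works for G′.
-- (⇐) Given (w′, t) for G′, exchangeable vertices of R get equal weight c
--     (swapping them turns one mds into another of the same weight). Extend
--     w′ by c on M ∖ R. A set D with |D ∩ M| ≤ |R| can be moved into U by
--     swapping vertices of D ∩ (M ∖ R) for vertices of R ∖ D; each swap
--     preserves both "D is an mds of G" (exchangeability in G) and the
--     weight of D, and on subsets of U the structure is that of G′. A set
--     with |D ∩ M| > |R| is no mds by (i) and weighs at least |D ∩ M| > |R| ≥ t.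

open import Defs hiding (sym)
open import Data.Nat using (ℕ; zero; suc; _+_; _≤_; _<_; z≤n; s≤s; _≤?_)
open import Data.Nat.Properties
  using (+-assoc; +-comm; +-identityʳ; +-cancelˡ-≡; +-cancelʳ-≡; suc-injective; +-mono-≤; ≤-trans; <⇒≱; 1+n≰n)
open import Data.Fin using (Fin; zero; suc; _≟_)
open import Data.Fin.Subset using (Subset; _∈_; _∉_; _⊆_; _⊂_; ⊤; _─_; _∩_; ∣_∣; Nonempty)
open import Data.Fin.Subset.Properties
  using (∈⊤; _∈?_; nonempty?; Empty-unique; ∣⊥∣≡0; x∈p∧x∉q⇒x∈p─q; x∈p∩q⁺; x∈p∩q⁻; p─q⊆p; p⊂q⇒∣p∣<∣q∣; x∈p⇒∣p-x∣<∣p∣)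
open import Data.Bool using (true; false; if_then_else_)
open import Data.Bool.Properties using (not-involutive)
open import Data.Vec using ([]; _∷_; lookup; here; there; _[_]=_)
open import Data.Vec.Properties
  using ([]=⇒lookup; lookup⇒[]=; []=-injective; updateAt-updates; updateAt-minimal; updateAt-updateAt-local; updateAt-id)
open import Data.Product using (_×_; _,_; proj₁; proj₂)
open import Data.Sum using (_⊎_; inj₁; inj₂)
open import Data.Empty using (⊥-elim)
open import Function using (_∘_)
open import Function.Bundles using (_⇔_; mk⇔; Equivalence)
open import Function.Construct.Composition using (_⇔-∘_)
open import Relation.Nullary using (¬_; yes; no)
open import Relation.Nullary.Decidable using (decidable-stable)
open import Relation.Binary.PropositionalEquality
  using (_≡_; _≢_; refl; sym; trans; cong; cong₂; subst; module ≡-Reasoning)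

open Equivalence using (to; from)
open ≡-Reasoning

∉⇒false : ∀ {n} {p : Subset n} {x} → x ∉ p → p [ x ]= false
∉⇒false {p = p} {x} x∉p with lookup p x in eq
... | true  = ⊥-elim (x∉p (lookup⇒[]= x p eq))
... | false = lookup⇒[]= x p eq

false⇒∉ : ∀ {n} {p : Subset n} {x} → p [ x ]= false → x ∉ p
false⇒∉ p[x]=false x∈p with []=-injective p[x]=false x∈p
... | ()

x∈p─q⇒x∉q : ∀ {n} (p q : Subset n) {x} → x ∈ p ─ q → x ∉ q
x∈p─q⇒x∉q (true ∷ p)  (false ∷ q) here ()
x∈p─q⇒x∉q (_ ∷ p)     (_ ∷ q)     (there x∈p─q) (there x∈q) = x∈p─q⇒x∉q p q x∈p─q x∈q

nonempty-of-card : ∀ {n} (p : Subset n) → 1 ≤ ∣ p ∣ → Nonempty p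
nonempty-of-card {n} p 1≤∣p∣ with nonempty? p
... | yes nonempty = nonempty
... | no empty
  with subst (1 ≤_) (trans (cong ∣_∣ (Empty-unique empty)) (∣⊥∣≡0 n)) 1≤∣p∣
... | ()

card-of-member : ∀ {n} {p : Subset n} {x} → x ∈ p → 1 ≤ ∣ p ∣
card-of-member x∈p = ≤-trans (s≤s z≤n) (x∈p⇒∣p-x∣<∣p∣ x∈p)

subset-or-witness : ∀ {n} (p q : Subset n) → p ⊆ q ⊎ Nonempty (p ─ q)
subset-or-witness p q with nonempty? (p ─ q)
... | yes witness = inj₂ witness
... | no empty    = inj₁ λ {x} x∈p →
  decidable-stable (x ∈? q) (λ x∉q → empty (x , x∈p∧x∉q⇒x∈p─q x∈p x∉q))

kept-contains : ∀ {n} (M R : Subset n) → R ⊆ ⊤ ─ (M ─ R)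
kept-contains M R x∈R = x∈p∧x∉q⇒x∈p─q ∈⊤ (λ x∈M─R → x∈p─q⇒x∉q M R x∈M─R x∈R)

toggle-in : ∀ {n} {D : Subset n} {x} → x ∉ D → x ∈ toggle D x
toggle-in {D = D} {x} x∉D = updateAt-updates x D (∉⇒false x∉D)

toggle-out : ∀ {n} {D : Subset n} {x} → x ∈ D → x ∉ toggle D x
toggle-out {D = D} {x} x∈D = false⇒∉ (updateAt-updates x D x∈D)

toggle-keeps-∈ : ∀ {n} {D : Subset n} {x y} → y ≢ x → y ∈ D → y ∈ toggle D x
toggle-keeps-∈ {D = D} {x} {y} y≢x y∈D = updateAt-minimal y x D y≢x y∈D

toggle-keeps-∉ : ∀ {n} {D : Subset n} {x y} → y ≢ x → y ∉ D → y ∉ toggle D x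
toggle-keeps-∉ {D = D} {x} {y} y≢x y∉D =
  false⇒∉ (updateAt-minimal y x D y≢x (∉⇒false y∉D))

toggle-involutive : ∀ {n} (D : Subset n) x → toggle (toggle D x) x ≡ D
toggle-involutive D x =
  trans (updateAt-updateAt-local x D (not-involutive (lookup D x))) (updateAt-id x D)

swap : ∀ {n} → Subset n → Fin n → Fin n → Subset n
swap D x y = toggle (toggle D x) y

swap-swap : ∀ {n} (D : Subset n) x y → swap (swap D x y) y x ≡ D
swap-swap D x y = begin
  toggle (toggle (toggle (toggle D x) y) y) x ≡⟨ cong (λ E → toggle E x) (toggle-involutive (toggle D x) y) ⟩
  toggle (toggle D x) x                       ≡⟨ toggle-involutive D x ⟩
  D                                           ∎

swap-reverses : ∀ {n} {D : Subset n} {x y} → x ∈ D → y ∉ D → x ≢ y →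
                y ∈ swap D x y × x ∉ swap D x y
swap-reverses x∈D y∉D x≢y =
  toggle-in (toggle-keeps-∉ (x≢y ∘ sym) y∉D) , toggle-keeps-∉ x≢y (toggle-out x∈D)

wsum-toggle-in : ∀ {n} (f : Fin n → ℕ) {D : Subset n} {x} → x ∈ D →
                 wsum (toggle D x) f + f x ≡ wsum D f
wsum-toggle-in f {true ∷ D}  here          = +-comm (wsum D (f ∘ suc)) (f zero)
wsum-toggle-in f {true ∷ D}  (there x∈D) =
  trans (+-assoc (f zero) _ _) (cong (f zero +_) (wsum-toggle-in (f ∘ suc) x∈D))
wsum-toggle-in f {false ∷ D} (there x∈D) = wsum-toggle-in (f ∘ suc) x∈D

wsum-toggle-out : ∀ {n} (f : Fin n → ℕ) {D : Subset n} {x} → x ∉ D →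
                  wsum (toggle D x) f ≡ wsum D f + f x
wsum-toggle-out f {D} {x} x∉D = begin
  wsum (toggle D x) f                  ≡⟨ sym (wsum-toggle-in f (toggle-in x∉D)) ⟩
  wsum (toggle (toggle D x) x) f + f x ≡⟨ cong (λ E → wsum E f + f x) (toggle-involutive D x) ⟩
  wsum D f + f x                       ∎

wsum-swap-in-out : ∀ {n} (f : Fin n → ℕ) {D : Subset n} {x y} → x ∈ D → y ∉ D → x ≢ y →
                   wsum (swap D x y) f + f x ≡ wsum D f + f y
wsum-swap-in-out f {D} {x} {y} x∈D y∉D x≢y = begin
  wsum (toggle (toggle D x) y) f + f x ≡⟨ cong (_+ f x) (wsum-toggle-out f (toggle-keeps-∉ (x≢y ∘ sym) y∉D)) ⟩
  wsum (toggle D x) f + f y + f x      ≡⟨ +-assoc (wsum (toggle D x) f) (f y) (f x) ⟩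
  wsum (toggle D x) f + (f y + f x)    ≡⟨ cong (wsum (toggle D x) f +_) (+-comm (f y) (f x)) ⟩
  wsum (toggle D x) f + (f x + f y)    ≡⟨ sym (+-assoc (wsum (toggle D x) f) (f x) (f y)) ⟩
  wsum (toggle D x) f + f x + f y      ≡⟨ cong (_+ f y) (wsum-toggle-in f x∈D) ⟩
  wsum D f + f y                       ∎

wsum-swap-out-in : ∀ {n} (f : Fin n → ℕ) {D : Subset n} {x y} → y ∈ D → x ∉ D → x ≢ y →
                   wsum (swap D x y) f + f y ≡ wsum D f + f x
wsum-swap-out-in f y∈D x∉D x≢y =
  trans (wsum-toggle-in f (toggle-keeps-∈ (x≢y ∘ sym) y∈D)) (wsum-toggle-out f x∉D)

swap-balanced : ∀ {n} (f : Fin n → ℕ) {D : Subset n} {x y} → f x ≡ f y →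
                x ∈ D → y ∉ D → x ≢ y → wsum (swap D x y) f ≡ wsum D f
swap-balanced f {D} fx≡fy x∈D y∉D x≢y =
  +-cancelʳ-≡ _ _ _ (trans (wsum-swap-in-out f x∈D y∉D x≢y) (cong (wsum D f +_) (sym fx≡fy)))

swap-determines-weights : ∀ {n} (f : Fin n → ℕ) {D : Subset n} {x y} → ExactlyOne x y D →
                          x ≢ y → wsum (swap D x y) f ≡ wsum D f → f x ≡ f y
swap-determines-weights f {D} (inj₁ (x∈D , y∉D)) x≢y same =
  +-cancelˡ-≡ (wsum D f) _ _
    (trans (cong (_+ f _) (sym same)) (wsum-swap-in-out f x∈D y∉D x≢y))
swap-determines-weights f {D} (inj₂ (y∈D , x∉D)) x≢y same =
  sym (+-cancelˡ-≡ (wsum D f) _ _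
    (trans (cong (_+ f _) (sym same)) (wsum-swap-out-in f y∈D x∉D x≢y)))

wsum-cong : ∀ {n} (D : Subset n) (f g : Fin n → ℕ) → (∀ x → x ∈ D → f x ≡ g x) →
            wsum D f ≡ wsum D g
wsum-cong []          f g f≡g = refl
wsum-cong (true ∷ D)  f g f≡g =
  cong₂ _+_ (f≡g zero here) (wsum-cong D (f ∘ suc) (g ∘ suc) (λ x x∈D → f≡g (suc x) (there x∈D)))
wsum-cong (false ∷ D) f g f≡g =
  wsum-cong D (f ∘ suc) (g ∘ suc) (λ x x∈D → f≡g (suc x) (there x∈D))

wsum-mono : ∀ {n} (D : Subset n) (f g : Fin n → ℕ) → (∀ x → f x ≤ g x) → wsum D f ≤ wsum D g
wsum-mono []          f g f≤g = z≤n
wsum-mono (true ∷ D)  f g f≤g = +-mono-≤ (f≤g zero) (wsum-mono D (f ∘ suc) (g ∘ suc) (f≤g ∘ suc))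
wsum-mono (false ∷ D) f g f≤g = wsum-mono D (f ∘ suc) (g ∘ suc) (f≤g ∘ suc)

χ : ∀ {n} → Subset n → Fin n → ℕ
χ S x = if lookup S x then 1 else 0

χ-∈ : ∀ {n} {S : Subset n} {x} → x ∈ S → χ S x ≡ 1
χ-∈ x∈S rewrite []=⇒lookup x∈S = refl

χ-∉ : ∀ {n} {S : Subset n} {x} → x ∉ S → χ S x ≡ 0
χ-∉ x∉S rewrite []=⇒lookup (∉⇒false x∉S) = refl

card-wsum : ∀ {n} (D S : Subset n) → ∣ D ∩ S ∣ ≡ wsum D (χ S)
card-wsum []          []          = refl
card-wsum (true ∷ D)  (true ∷ S)  = cong suc (card-wsum D S)
card-wsum (true ∷ D)  (false ∷ S) = card-wsum D S
card-wsum (false ∷ D) (_ ∷ S)     = card-wsum D S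

card-≤-wsum : ∀ {n} (D S : Subset n) (f : Fin n → ℕ) → (∀ x → x ∈ S → 1 ≤ f x) →
              ∣ D ∩ S ∣ ≤ wsum D f
card-≤-wsum D S f positive =
  subst (_≤ wsum D f) (sym (card-wsum D S)) (wsum-mono D (χ S) f χ≤f)
  where
  χ≤f : ∀ x → χ S x ≤ f x
  χ≤f x with lookup S x in eq
  ... | true  = positive x (lookup⇒[]= x S eq)
  ... | false = z≤n

card-swap-out : ∀ {n} {D S : Subset n} {x y} → x ∈ S → y ∉ S →
                x ∈ D → y ∉ D → x ≢ y → suc ∣ swap D x y ∩ S ∣ ≡ ∣ D ∩ S ∣
card-swap-out {D = D} {S} {x} {y} x∈S y∉S x∈D y∉D x≢y = begin
  suc ∣ swap D x y ∩ S ∣           ≡⟨ +-comm 1 _ ⟩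
  ∣ swap D x y ∩ S ∣ + 1           ≡⟨ cong₂ _+_ (card-wsum (swap D x y) S) (sym (χ-∈ x∈S)) ⟩
  wsum (swap D x y) (χ S) + χ S x ≡⟨ wsum-swap-in-out (χ S) x∈D y∉D x≢y ⟩
  wsum D (χ S) + χ S y            ≡⟨ cong₂ _+_ (sym (card-wsum D S)) (χ-∉ y∉S) ⟩
  ∣ D ∩ S ∣ + 0                    ≡⟨ +-identityʳ _ ⟩
  ∣ D ∩ S ∣                        ∎

card-swap-within : ∀ {n} {D S : Subset n} {x y} → x ∈ S → y ∈ S →
                   x ∈ D → y ∉ D → x ≢ y → ∣ swap D x y ∩ S ∣ ≡ ∣ D ∩ S ∣
card-swap-within {D = D} {S} x∈S y∈S x∈D y∉D x≢y =
  trans (card-wsum _ S)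
    (trans (swap-balanced (χ S) (trans (χ-∈ x∈S) (sym (χ-∈ y∈S))) x∈D y∉D x≢y)
           (sym (card-wsum D S)))

-- A property P of vertex sets that holds on subsets of
-- ⊤ ─ (M ─ R), and that transfers back along every trade of some
-- x ∈ D ∩ (M ─ R) for some y ∈ R ∖ D, holds for every D with
-- |D ∩ M| ≤ |R|: such a D can be traded into ⊤ ─ (M ─ R), since as long
-- as D meets M ─ R, R ⊆ D would force |D ∩ M| > |R|.
swap-induction :
  ∀ {n} (M R : Subset n) → R ⊆ M → (P : Subset n → Set) →
  (∀ {D x y} → x ∈ M ─ R → y ∈ R → x ∈ D → y ∉ D → P (swap D x y) → P D) →
  (∀ {D} → D ⊆ ⊤ ─ (M ─ R) → P D) →
  ∀ D → ∣ D ∩ M ∣ ≤ ∣ R ∣ → P D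
swap-induction M R R⊆M P step base D fits = by-excess _ D refl fits
  where
  by-excess : ∀ m D → ∣ D ∩ (M ─ R) ∣ ≡ m → ∣ D ∩ M ∣ ≤ ∣ R ∣ → P D
  by-excess zero D no-excess _ = base λ {x} x∈D → x∈p∧x∉q⇒x∈p─q ∈⊤ λ x∈M─R →
    1+n≰n (subst (1 ≤_) no-excess (card-of-member (x∈p∩q⁺ (x∈D , x∈M─R))))
  by-excess (suc m) D excess few
    with nonempty-of-card (D ∩ (M ─ R)) (subst (1 ≤_) (sym excess) (s≤s z≤n))
  ... | x , x∈D∩M─R
    with x∈p∩q⁻ D (M ─ R) x∈D∩M─R | subset-or-witness R D
  ... | x∈D , x∈M─R | inj₁ R⊆D =
    ⊥-elim (<⇒≱ (p⊂q⇒∣p∣<∣q∣ R⊂D∩M) few)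
    where
    R⊂D∩M : R ⊂ D ∩ M
    R⊂D∩M = (λ y∈R → x∈p∩q⁺ (R⊆D y∈R , R⊆M y∈R))
          , x , x∈p∩q⁺ (x∈D , p─q⊆p M R x∈M─R) , x∈p─q⇒x∉q M R x∈M─R
  ... | x∈D , x∈M─R | inj₂ (y , y∈R─D) =
    step x∈M─R y∈R x∈D y∉D (by-excess m (swap D x y) excess′ few′)
    where
    y∈R : y ∈ R
    y∈R = p─q⊆p R D y∈R─D
    y∉D : y ∉ D
    y∉D = x∈p─q⇒x∉q R D y∈R─D
    x∈M : x ∈ M
    x∈M = p─q⊆p M R x∈M─R
    x≢y : x ≢ y
    x≢y refl = x∈p─q⇒x∉q M R x∈M─R y∈R
    excess′ : ∣ swap D x y ∩ (M ─ R) ∣ ≡ m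
    excess′ = suc-injective (trans
      (card-swap-out x∈M─R (λ y∈M─R → x∈p─q⇒x∉q M R y∈M─R y∈R) x∈D y∉D x≢y) excess)
    few′ : ∣ swap D x y ∩ M ∣ ≤ ∣ R ∣
    few′ = subst (_≤ ∣ R ∣) (sym (card-swap-within x∈M (R⊆M y∈R) x∈D y∉D x≢y)) few

module _ {n : ℕ} (G : Graph n) where

  mds-restrict : ∀ {U D} → (∀ E → Dominating G U E → Dominating G ⊤ E) → D ⊆ U →
                 IsMDS G U D ⇔ IsMDS G ⊤ D
  mds-restrict {U} {D} lift D⊆U = mk⇔ up down
    where
    restrict : ∀ {E} → E ⊆ U → Dominating G ⊤ E → Dominating G U E
    restrict E⊆U (_ , dominates) = E⊆U , λ v _ → dominates v ∈⊤

    up : IsMDS G U D → IsMDS G ⊤ D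
    up (dominatesU , minimal) =
      lift D dominatesU , λ E E⊆D dominatesE → minimal E E⊆D (restrict (D⊆U ∘ E⊆D) dominatesE)

    down : IsMDS G ⊤ D → IsMDS G U D
    down (dominates , minimal) =
      restrict D⊆U dominates , λ E E⊆D dominatesE → minimal E E⊆D (lift E dominatesE)

  exchange-mds : ∀ {U D x y} → MdsExchangeable G U x y → MdsExchangeable G U y x →
                 x ∈ D → y ∉ D → x ≢ y → IsMDS G U D ⇔ IsMDS G U (swap D x y)
  exchange-mds {U} {D} {x} {y} (_ , preservesxy) (_ , preservesyx) x∈D y∉D x≢y =
    mk⇔ (λ mds → preservesxy D mds (inj₁ (x∈D , y∉D)))
        (λ mds → subst (IsMDS G U) (swap-swap D x y) (preservesyx (swap D x y) mds (inj₁ (swap-reverses x∈D y∉D x≢y))))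

  exchangeable-weights : ∀ {U x y} (w : Fin n → ℕ) {t} → (∀ D → IsMDS G U D → wsum D w ≡ t) →
                         MdsExchangeable G U x y → x ≢ y → w x ≡ w y
  exchangeable-weights w weight ((D , mds , exactlyOne) , preserves) x≢y =
    swap-determines-weights w exactlyOne x≢y
      (trans (weight _ (preserves D mds exactlyOne)) (sym (weight D mds)))

  exchangeable-mono : ∀ {U S T} → S ⊆ T → PairwiseExchangeable G U T → PairwiseExchangeable G U S
  exchangeable-mono S⊆T exchangeable x y x∈S y∈S = exchangeable x y (S⊆T x∈S) (S⊆T y∈S)

  restrict-equidominating : ∀ {U t k} → (∀ D → Dominating G U D → Dominating G ⊤ D) →
                            TargetKEquidominating G ⊤ t k → TargetKEquidominating G U t k
  restrict-equidominating lift (w , bounded , 1≤t , equidominating) =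
    w , (λ v _ → bounded v ∈⊤) , 1≤t , λ D D⊆U →
      equidominating D (λ _ → ∈⊤) ⇔-∘ mds-restrict lift D⊆U

module Extension {n : ℕ} (G : Graph n) (M R : Subset n) (R⊆M : R ⊆ M)
  (exchangeableM : PairwiseExchangeable G ⊤ M)
  (exchangeableR : PairwiseExchangeable G (⊤ ─ (M ─ R)) R)
  (few : ∀ D → IsMDS G ⊤ D → ∣ D ∩ M ∣ ≤ ∣ R ∣)
  (lift : ∀ D → Dominating G (⊤ ─ (M ─ R)) D → Dominating G ⊤ D)
  where

  U : Subset n
  U = ⊤ ─ (M ─ R)

  kept-in-R : ∀ {v} → v ∈ M → v ∉ M ─ R → v ∈ R
  kept-in-R {v} v∈M v∉M─R = decidable-stable (v ∈? R) (λ v∉R → v∉M─R (x∈p∧x∉q⇒x∈p─q v∈M v∉R))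

  module Weights {t k : ℕ} (t≤∣R∣ : t ≤ ∣ R ∣) (w′ : Fin n → ℕ)
    (bounded′ : ∀ v → v ∈ U → 1 ≤ w′ v × w′ v ≤ k) (1≤t : 1 ≤ t)
    (equidominating′ : ∀ D → D ⊆ U → (IsMDS G U D ⇔ (wsum D w′ ≡ t))) where

    r₀∈R : Nonempty R
    r₀∈R = nonempty-of-card R (≤-trans 1≤t t≤∣R∣)

    r₀ : Fin n
    r₀ = proj₁ r₀∈R

    c : ℕ
    c = w′ r₀

    w′-on-R : ∀ {y} → y ∈ R → w′ y ≡ c
    w′-on-R {y} y∈R with y ≟ r₀
    ... | yes refl = refl
    ... | no y≢r₀ = exchangeable-weights G w′
      (λ D mds → to (equidominating′ D (proj₁ (proj₁ mds))) mds)
      (exchangeableR y r₀ y∈R (proj₂ r₀∈R) y≢r₀) y≢r₀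

    w : Fin n → ℕ
    w v = if lookup (M ─ R) v then c else w′ v

    w-on-U : ∀ {v} → v ∈ U → w v ≡ w′ v
    w-on-U v∈U rewrite []=⇒lookup (∉⇒false (x∈p─q⇒x∉q ⊤ (M ─ R) v∈U)) = refl

    w-on-M : ∀ {v} → v ∈ M → w v ≡ c
    w-on-M {v} v∈M with lookup (M ─ R) v in eq
    ... | true  = refl
    ... | false = w′-on-R (kept-in-R v∈M (false⇒∉ (lookup⇒[]= v (M ─ R) eq)))

    bounded : ∀ v → v ∈ ⊤ → 1 ≤ w v × w v ≤ k
    bounded v _ with lookup (M ─ R) v in eq
    ... | true  = bounded′ r₀ (kept-contains M R (proj₂ r₀∈R))
    ... | false = bounded′ v (x∈p∧x∉q⇒x∈p─q ∈⊤ (false⇒∉ (lookup⇒[]= v (M ─ R) eq)))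

    kept-sets : ∀ {D} → D ⊆ U → IsMDS G ⊤ D ⇔ (wsum D w ≡ t)
    kept-sets {D} D⊆U = mk⇔
      (λ mds → trans same (to (equidominating′ D D⊆U) (from (mds-restrict G lift D⊆U) mds)))
      (λ weight → to (mds-restrict G lift D⊆U) (from (equidominating′ D D⊆U) (trans (sym same) weight)))
      where
      same : wsum D w ≡ wsum D w′
      same = wsum-cong D w w′ (λ x x∈D → w-on-U (D⊆U x∈D))

    trade : ∀ {D x y} → x ∈ M ─ R → y ∈ R → x ∈ D → y ∉ D →
            (IsMDS G ⊤ (swap D x y) ⇔ (wsum (swap D x y) w ≡ t)) → IsMDS G ⊤ D ⇔ (wsum D w ≡ t)
    trade {D} {x} {y} x∈M─R y∈R x∈D y∉D swapped = mk⇔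
      (λ mds → trans (sym same) (to swapped (to exchange mds)))
      (λ weight → from exchange (from swapped (trans same weight)))
      where
      x∈M : x ∈ M
      x∈M = p─q⊆p M R x∈M─R
      x≢y : x ≢ y
      x≢y refl = x∈p─q⇒x∉q M R x∈M─R y∈R
      exchange : IsMDS G ⊤ D ⇔ IsMDS G ⊤ (swap D x y)
      exchange = exchange-mds G (exchangeableM x y x∈M (R⊆M y∈R) x≢y)
        (exchangeableM y x (R⊆M y∈R) x∈M (x≢y ∘ sym)) x∈D y∉D x≢y
      same : wsum (swap D x y) w ≡ wsum D w
      same = swap-balanced w (trans (w-on-M x∈M) (sym (w-on-M (R⊆M y∈R)))) x∈D y∉D x≢y

    crowded-sets : ∀ {D} → ¬ (∣ D ∩ M ∣ ≤ ∣ R ∣) → IsMDS G ⊤ D ⇔ (wsum D w ≡ t)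
    crowded-sets {D} crowded = mk⇔
      (λ mds → ⊥-elim (crowded (few D mds)))
      (λ weight → ⊥-elim (crowded (≤-trans (card-≤-wsum D M w (λ v _ → proj₁ (bounded v ∈⊤)))
                                           (subst (_≤ ∣ R ∣) (sym weight) t≤∣R∣))))

    extended : TargetKEquidominating G ⊤ t k
    extended = w , bounded , 1≤t , λ D _ → equidominating D
      where
      equidominating : ∀ D → IsMDS G ⊤ D ⇔ (wsum D w ≡ t)
      equidominating D with ∣ D ∩ M ∣ ≤? ∣ R ∣
      ... | yes fits = swap-induction M R R⊆M (λ D → IsMDS G ⊤ D ⇔ (wsum D w ≡ t)) trade kept-sets D fits
      ... | no crowded = crowded-sets crowded

  extend-equidominating : ∀ {t k} → t ≤ ∣ R ∣ →
                          TargetKEquidominating G U t k → TargetKEquidominating G ⊤ t k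
  extend-equidominating t≤∣R∣ (w′ , bounded′ , 1≤t , equidominating′) =
    Weights.extended t≤∣R∣ w′ bounded′ 1≤t equidominating′

lemma5p1 : ∀ {n : ℕ} (G : Graph n) (r k : ℕ) → 1 ≤ r → 1 ≤ k →
    (M : Subset n) → PairwiseExchangeable G ⊤ M → r < ∣ M ∣ →
    (R : Subset n) → R ⊆ M → ∣ R ∣ ≡ r →
    (∀ D → IsMDS G ⊤ D → ∣ D ∩ M ∣ ≤ r) →
    PairwiseExchangeable G (⊤ ─ (M ─ R)) (M ∩ (⊤ ─ (M ─ R))) →
    (∀ D → Dominating G (⊤ ─ (M ─ R)) D → Dominating G ⊤ D) →
    ∀ t → t ≤ r →
    (TargetKEquidominating G ⊤ t k ⇔ TargetKEquidominating G (⊤ ─ (M ─ R)) t k)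
lemma5p1 G .(∣ R ∣) k _ _ M exchangeableM _ R R⊆M refl few exchangeable′ lift t t≤∣R∣ =
  mk⇔ (restrict-equidominating G lift)
      (Extension.extend-equidominating G M R R⊆M exchangeableM exchangeableR few lift t≤∣R∣)
  where
  exchangeableR : PairwiseExchangeable G (⊤ ─ (M ─ R)) R
  exchangeableR = exchangeable-mono G (λ x∈R → x∈p∩q⁺ (R⊆M x∈R , kept-contains M R x∈R)) exchangeable′
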